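{- Let $G$ be a directed cycle (ring) on $n$ vertices and let $\alpha=(n-1)+k$ with $1\le k\le n-1$. Then $\tau(G,\text{all paths},\alpha)=\Theta(n/k)$; in particular $$\left\lfloor\frac{n-1}{k+1}\right\rfloor+1\le\tau(G,\text{all paths},\alpha)\le\left\lceil\frac{n}{k+1}\right\rceil+1.$$ Moreover, $\tau(G,\text{all paths},n-1)=n-1$.
   Context: For a digraph $G=(V,E)$, a labeling is a map $\lambda:E\to 2^{\mathbb{N}}$; $\lambda_{\min},\lambda_{\max}$ are the minimum and maximum labels used and the age is $\alpha(\lambda)=\lambda_{\max}-\lambda_{\min}+1$; $\mathcal{L}_{G,k}$ is the set of labelings with age at most $k$. $\lambda$ preserves a path $(e_1,\dots,e_k)$ if there are labels $l_1<\dots<l_k$ with $l_i\in\lambda(e_i)$. all-paths$(G)$ is the set of labelings preserving every simple path of $G$, and $\tau(G,\text{all paths},a)=\min_{\lambda\in\text{all-paths}(G)\cap\mathcal{L}_{G,a}}\max_{e\in E}|\lambda(e)|$. -}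

module Defs where

open import Data.Nat using (ℕ; zero; suc; _+_; _∸_; _≤_; _<_)
open import Data.Nat.DivMod using (_/_; _mod_)
open import Data.Fin using (Fin; toℕ)
open import Data.List using (List; []; _∷_; map; length)
open import Data.List.Membership.Propositional using (_∈_)
open import Data.List.Relation.Unary.Unique.Propositional using (Unique)
open import Data.List.Relation.Unary.Linked using (Linked)
open import Data.List.Relation.Binary.Pointwise using (Pointwise)
open import Data.Product using (Σ; ∃; ∃-syntax; _×_)
open import Relation.Binary.PropositionalEquality using (_≡_)

record Digraph : Set where
  field
    nV  : ℕ
    nE  : ℕ
    src : Fin nE → Fin nV
    tgt : Fin nE → Fin nV
open Digraph public

ring : (n : ℕ) → Digraph
ring zero    = record { nV = zero ; nE = zero ; src = λ () ; tgt = λ () }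
ring (suc m) = record { nV = suc m ; nE = suc m ; src = λ i → i
                      ; tgt = λ i → suc (toℕ i) mod (suc m) }

Path : Digraph → Set
Path G = List (Fin (nE G))

Consecutive : (G : Digraph) → Path G → Set
Consecutive G = Linked (λ e f → tgt G e ≡ src G f)

vertices : (G : Digraph) → Path G → List (Fin (nV G))
vertices G []       = []
vertices G (e ∷ es) = src G e ∷ map (tgt G) (e ∷ es)

SimplePath : (G : Digraph) → Path G → Set
SimplePath G p = Consecutive G p × Unique (vertices G p)

-- A labeling assigns to every edge a finite set of natural-number labels,
-- represented as a duplicate-free list (so |λ(e)| = length).
Labeling : Digraph → Set
Labeling G = Fin (nE G) → List ℕ

WellFormed : (G : Digraph) → Labeling G → Set
WellFormed G lab = ∀ e → Unique (lab e)

∣_∣ₗ : List ℕ → ℕ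
∣ xs ∣ₗ = length xs

Preserves : (G : Digraph) → Labeling G → Path G → Set
Preserves G lab p = ∃[ ls ] (Pointwise _∈_ ls (map lab p) × Linked _<_ ls)

AllPaths : (G : Digraph) → Labeling G → Set
AllPaths G lab = ∀ (p : Path G) → SimplePath G p → Preserves G lab p

-- α(λ) = λ_max − λ_min + 1 ≤ a : all used labels lie in a window [m, m + a) of length a
AgeAtMost : (G : Digraph) → Labeling G → ℕ → Set
AgeAtMost G lab a = ∃[ m ] (∀ e l → l ∈ lab e → m ≤ l × l < m + a)

Admissible : (G : Digraph) → ℕ → Labeling G → Set
Admissible G a lab = WellFormed G lab × AllPaths G lab × AgeAtMost G lab a

-- τ(G, all paths, a) ≤ t : some admissible labeling has max_e |λ(e)| ≤ t
τ≤ : Digraph → ℕ → ℕ → Set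
τ≤ G a t = ∃[ lab ] (Admissible G a lab × (∀ e → ∣ lab e ∣ₗ ≤ t))

-- t ≤ τ(G, all paths, a) : every admissible labeling has max_e |λ(e)| ≥ t
τ≥ : Digraph → ℕ → ℕ → Set
τ≥ G a t = ∀ lab → Admissible G a lab → ∃[ e ] (t ≤ ∣ lab e ∣ₗ)

ceil/ : ℕ → ℕ → ℕ
ceil/ m d = (m + d) / suc d

module Submission where

-- τ(ring n, all paths, (n−1)+k) lies between ⌊(n−1)/(k+1)⌋+1 and ⌈n/(k+1)⌉+1, and
-- τ(ring n, all paths, n−1) = n−1.  The simple paths of the ring are its arcs of at most
-- n−1 edges, and a labeling preserves an arc iff it carries a strictly increasing chain
-- of labels along it.
-- Lower bound: a chain along a maximal arc (n−1 edges) in a window of length (n−1)+k has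
-- its p-th label in [m₀+p, m₀+p+k].  Each edge is the p-th edge of a maximal arc for every
-- p, so it has a label in each of the disjoint intervals p = 0, k+1, 2(k+1), …: that is
-- ⌊(n−1)/(k+1)⌋ labels.  One more: either some maximal chain ends at or above m₀+n−1, so
-- its last edge has an extra label, or all maximal chains are tight and one edge carries
-- all the labels m₀, …, m₀+n−2.
-- Upper bound: the arc starting at edge s uses the labels s mod (k+1), +1, +2, …; an
-- explicit formula shows each edge needs only ⌊(n−1)/(k+1)⌋+2 of them.

open import Defs
open import Data.Nat using (ℕ; zero; suc; _+_; _*_; _∸_; _≤_; _<_; _⊓_; z≤n; s≤s; _≤?_; _<?_; _≟_)
open import Data.Nat.Properties
open import Data.Nat.DivMod
open import Data.Nat.Tactic.RingSolver using (solve-∀)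
open import Data.Fin using (Fin; toℕ) renaming (zero to fzero)
open import Data.Fin.Properties using (toℕ-fromℕ<; toℕ<n; toℕ-injective)
open import Data.List using (List; []; _∷_; _++_; map; length; applyUpTo; upTo; deduplicate)
open import Data.List.Properties using (length-++; length-applyUpTo; map-applyUpTo; length-upTo; length-deduplicate)
open import Data.List.Membership.Propositional using (_∈_)
open import Data.List.Membership.Propositional.Properties
  using (∈-∃++; ∈-++⁻; ∈-++⁺ˡ; ∈-++⁺ʳ; ∈-applyUpTo⁺; ∈-applyUpTo⁻; ∈-upTo⁺; ∈-upTo⁻; ∈-deduplicate⁺; ∈-deduplicate⁻)
open import Data.List.Relation.Unary.Any using (here; there)
open import Data.List.Relation.Unary.All as All using (All; []; _∷_)
open import Data.List.Relation.Unary.All.Properties using (applyUpTo⁺₁; applyUpTo⁻)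
open import Data.List.Relation.Unary.AllPairs as AllPairs using ([]; _∷_)
open import Data.List.Relation.Unary.Unique.Propositional using (Unique)
import Data.List.Relation.Unary.Unique.Propositional.Properties as Unique
open import Data.List.Relation.Unary.Unique.DecPropositional.Properties _≟_ using (deduplicate-!; upTo⁺)
open import Data.List.Relation.Unary.Linked using (Linked; []; [-]; _∷_)
open import Data.List.Relation.Unary.Linked.Properties using (Linked⇒AllPairs)
open import Data.List.Relation.Binary.Pointwise using (Pointwise; []; _∷_; Pointwise-length)
open import Data.Product using (Σ; ∃; _×_; _,_; proj₁; proj₂)
open import Data.Sum using (_⊎_; inj₁; inj₂; [_,_]′)
open import Function using (_∘_)
open import Relation.Nullary using (yes; no; contradiction)
open import Relation.Binary.PropositionalEquality

private variable
  A B : Set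

-- A duplicate-free list contained in ys is at most as long as ys; this is how
-- "an edge carries t distinct labels" becomes a bound on |λ(e)|.
unique⊆⇒length≤ : {xs ys : List A} → Unique xs → (∀ {x} → x ∈ xs → x ∈ ys) →
                  length xs ≤ length ys
unique⊆⇒length≤ {xs = []} _ _ = z≤n
unique⊆⇒length≤ {xs = x ∷ xs} (x∉xs ∷ unique-xs) xs⊆ys with ∈-∃++ (xs⊆ys (here refl))
... | as , bs , refl = begin
    suc (length xs)             ≤⟨ s≤s (unique⊆⇒length≤ unique-xs xs⊆as++bs) ⟩
    suc (length (as ++ bs))     ≡⟨ cong suc (length-++ as) ⟩
    suc (length as + length bs) ≡⟨ sym (+-suc (length as) (length bs)) ⟩
    length as + length (x ∷ bs) ≡⟨ sym (length-++ as) ⟩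
    length (as ++ x ∷ bs)       ∎
  where
    open ≤-Reasoning
    xs⊆as++bs : ∀ {y} → y ∈ xs → y ∈ as ++ bs
    xs⊆as++bs y∈xs with ∈-++⁻ as (xs⊆ys (there y∈xs))
    ... | inj₁ y∈as         = ∈-++⁺ˡ y∈as
    ... | inj₂ (here refl)  = contradiction refl (All.lookup x∉xs y∈xs)
    ... | inj₂ (there y∈bs) = ∈-++⁺ʳ as y∈bs

increasing⇒unique : {xs : List ℕ} → Linked _<_ xs → Unique xs
increasing⇒unique = AllPairs.map <⇒≢ ∘ Linked⇒AllPairs <-trans

applyUpTo-linked : {R : A → A → Set} (f : ℕ → A) (K : ℕ) →
                   (∀ i → suc i < K → R (f i) (f (suc i))) → Linked R (applyUpTo f K)
applyUpTo-linked f zero          _    = []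
applyUpTo-linked f (suc zero)    _    = [-]
applyUpTo-linked f (suc (suc K)) step =
  step 0 (s≤s (s≤s z≤n)) ∷ applyUpTo-linked (f ∘ suc) (suc K) (λ i i<K → step (suc i) (s≤s i<K))

applyUpTo-pointwise : {R : A → B → Set} (f : ℕ → A) (g : ℕ → B) (K : ℕ) →
                      (∀ i → i < K → R (f i) (g i)) → Pointwise R (applyUpTo f K) (applyUpTo g K)
applyUpTo-pointwise f g zero    _   = []
applyUpTo-pointwise f g (suc K) rel =
  rel 0 (s≤s z≤n) ∷ applyUpTo-pointwise (f ∘ suc) (g ∘ suc) K (λ i i<K → rel (suc i) (s≤s i<K))

-- The i-th entry of a list of numbers (0 past the end), to read a list as a chain ℕ → ℕ.
entry : List ℕ → ℕ → ℕ
entry []       _       = 0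
entry (x ∷ _)  zero    = x
entry (_ ∷ xs) (suc i) = entry xs i

pointwise-entry : {R : ℕ → B → Set} {ls : List ℕ} (g : ℕ → B) (K : ℕ) →
                  Pointwise R ls (applyUpTo g K) → ∀ i → i < K → R (entry ls i) (g i)
pointwise-entry g (suc K) (r ∷ _)  zero    _         = r
pointwise-entry g (suc K) (_ ∷ rs) (suc i) (s≤s i<K) = pointwise-entry (g ∘ suc) K rs i i<K

linked-entry : {R : ℕ → ℕ → Set} {ls : List ℕ} → Linked R ls →
               ∀ i → suc i < length ls → R (entry ls i) (entry ls (suc i))
linked-entry []       _       ()
linked-entry [-]      _       (s≤s ())
linked-entry (r ∷ _)  zero    _        = r
linked-entry (_ ∷ rs) (suc i) (s≤s lt) = linked-entry rs i lt

increasing⇒gap : (ℓ : ℕ → ℕ) (K : ℕ) → (∀ j → suc j < K → ℓ j < ℓ (suc j)) →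
                 ∀ i d → i + d < K → ℓ i + d ≤ ℓ (i + d)
increasing⇒gap ℓ K inc i zero _ =
  ≤-reflexive (trans (+-identityʳ (ℓ i)) (cong ℓ (sym (+-identityʳ i))))
increasing⇒gap ℓ K inc i (suc d) i+1+d<K = begin
    ℓ i + suc d     ≡⟨ +-suc (ℓ i) d ⟩
    suc (ℓ i + d)   ≤⟨ s≤s (increasing⇒gap ℓ K inc i d (<-trans (n<1+n (i + d)) 1+i+d<K)) ⟩
    suc (ℓ (i + d)) ≤⟨ inc (i + d) 1+i+d<K ⟩
    ℓ (suc (i + d)) ≡⟨ cong ℓ (sym (+-suc i d)) ⟩
    ℓ (i + suc d)   ∎
  where
    open ≤-Reasoning
    1+i+d<K : suc (i + d) < K
    1+i+d<K = subst (_< K) (+-suc i d) i+1+d<K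

all-or-some : {X : Set} {P : ℕ → Set} (J : ℕ) →
              (∀ j → j < J → X ⊎ P j) → X ⊎ (∀ j → j < J → P j)
all-or-some zero _ = inj₂ (λ _ ())
all-or-some (suc J) choice with all-or-some J (λ j j<J → choice j (m<n⇒m<1+n j<J)) | choice J ≤-refl
... | inj₁ x     | _        = inj₁ x
... | inj₂ _     | inj₁ x   = inj₁ x
... | inj₂ below | inj₂ atJ =
  inj₂ λ j j<1+J → [ below j , (λ { refl → atJ }) ]′ (m<1+n⇒m<n∨m≡n j<1+J)

age-mono : (G : Digraph) (lab : Labeling G) {a b : ℕ} → a ≤ b → AgeAtMost G lab a → AgeAtMost G lab b
age-mono G lab a≤b (m₀ , window) =
  m₀ , λ e l l∈ → proj₁ (window e l l∈) , <-≤-trans (proj₂ (window e l l∈)) (+-monoʳ-≤ m₀ a≤b)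

-- Arcs in the ring on n = m+1 vertices

module Ring (m : ℕ) where

  n : ℕ
  n = suc m

  G : Digraph
  G = ring n

  next : Fin n → Fin n
  next = tgt G

  walk : ℕ → Fin n → Fin n
  walk zero    e = e
  walk (suc j) e = walk j (next e)

  arc : Fin n → ℕ → Path G
  arc e L = applyUpTo (λ j → walk j e) L

  walk-add : ∀ p q e → walk p (walk q e) ≡ walk (q + p) e
  walk-add p zero    e = refl
  walk-add p (suc q) e = walk-add p q (next e)

  %-absorbˡ : ∀ a j → (a % n + j) % n ≡ (a + j) % n
  %-absorbˡ a j = begin
      (a % n + j) % n           ≡⟨ %-distribˡ-+ (a % n) j n ⟩
      (a % n % n + j % n) % n   ≡⟨ cong (λ x → (x + j % n) % n) (m%n%n≡m%n a n) ⟩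
      (a % n + j % n) % n       ≡⟨ sym (%-distribˡ-+ a j n) ⟩
      (a + j) % n               ∎
    where open ≡-Reasoning

  toℕ-walk : ∀ j e → toℕ (walk j e) ≡ (toℕ e + j) % n
  toℕ-walk zero e = sym (trans (cong (_% n) (+-identityʳ (toℕ e))) (m<n⇒m%n≡m (toℕ<n e)))
  toℕ-walk (suc j) e = begin
      toℕ (walk j (next e))          ≡⟨ toℕ-walk j (next e) ⟩
      (toℕ (next e) + j) % n         ≡⟨ cong (λ x → (x + j) % n) (toℕ-fromℕ< (m%n<n (suc (toℕ e)) n)) ⟩
      (suc (toℕ e) % n + j) % n      ≡⟨ %-absorbˡ (suc (toℕ e)) j ⟩
      (suc (toℕ e) + j) % n          ≡⟨ cong (_% n) (sym (+-suc (toℕ e) j)) ⟩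
      (toℕ e + suc j) % n            ∎
    where open ≡-Reasoning

  walk-within : ∀ j e → toℕ e + j < n → toℕ (walk j e) ≡ toℕ e + j
  walk-within j e lt = trans (toℕ-walk j e) (m<n⇒m%n≡m lt)

  walk-wrap : ∀ j e → n ≤ toℕ e + j → j ≤ n → toℕ (walk j e) + n ≡ toℕ e + j
  walk-wrap j e n≤e+j j≤n = begin
      toℕ (walk j e) + n          ≡⟨ cong (_+ n) (toℕ-walk j e) ⟩
      (toℕ e + j) % n + n         ≡⟨ cong (_+ n) (sym (m≤n⇒[n∸m]%m≡n%m n≤e+j)) ⟩
      (toℕ e + j ∸ n) % n + n     ≡⟨ cong (_+ n) (m<n⇒m%n≡m e+j∸n<n) ⟩
      toℕ e + j ∸ n + n           ≡⟨ m∸n+n≡m n≤e+j ⟩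
      toℕ e + j                   ∎
    where
      open ≡-Reasoning
      e+j∸n<n : toℕ e + j ∸ n < n
      e+j∸n<n = ≤-<-trans (∸-monoˡ-≤ n (+-monoʳ-≤ (toℕ e) j≤n))
                          (subst (_< n) (sym (m+n∸n≡m (toℕ e) n)) (toℕ<n e))

  walk-period : ∀ e → walk n e ≡ e
  walk-period e = toℕ-injective
    (+-cancelʳ-≡ _ _ _ (walk-wrap n e (m≤n+m n (toℕ e)) ≤-refl))

  walk-ne : ∀ i e → 0 < i → i < n → walk i e ≢ e
  walk-ne i e 0<i i<n eq with toℕ e + i <? n
  ... | yes e+i<n = <⇒≢ (m<m+n (toℕ e) 0<i) (sym (trans (sym (walk-within i e e+i<n)) (cong toℕ eq)))
  ... | no  e+i≮n = <⇒≢ i<n (sym (+-cancelˡ-≡ (toℕ e) _ _ (begin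
          toℕ e + n          ≡⟨ cong (_+ n) (sym (cong toℕ eq)) ⟩
          toℕ (walk i e) + n ≡⟨ walk-wrap i e (≮⇒≥ e+i≮n) (<⇒≤ i<n) ⟩
          toℕ e + i          ∎)))
    where open ≡-Reasoning

  back : ℕ → Fin n → Fin n
  back p e = walk (n ∸ p) e

  walk-back : ∀ p e → p ≤ n → walk p (back p e) ≡ e
  walk-back p e p≤n = trans (walk-add p (n ∸ p) e)
                            (trans (cong (λ x → walk x e) (m∸n+n≡m p≤n)) (walk-period e))

  arc-unique : ∀ e L → L ≤ n → Unique (arc e L)
  arc-unique e L L≤n = Unique.applyUpTo⁺₁ (λ j → walk j e) L distinct
    where
      distinct : ∀ {i j} → i < j → j < L → walk i e ≢ walk j e
      distinct {i} {j} i<j j<L eq = walk-ne (j ∸ i) (walk i e) (m<n⇒0<n∸m i<j)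
        (≤-<-trans (m∸n≤m j i) (<-≤-trans j<L L≤n))
        (trans (walk-add (j ∸ i) i e) (trans (cong (λ x → walk x e) (m+[n∸m]≡n (<⇒≤ i<j))) (sym eq)))

  arc-consecutive : ∀ e L → Consecutive G (arc e L)
  arc-consecutive e zero          = []
  arc-consecutive e (suc zero)    = [-]
  arc-consecutive e (suc (suc L)) = refl ∷ arc-consecutive (next e) (suc L)

  map-next-arc : ∀ e L → map next (arc e L) ≡ arc (next e) L
  map-next-arc e zero    = refl
  map-next-arc e (suc L) = cong (next e ∷_) (map-next-arc (next e) L)

  vertices-arc : ∀ e L → vertices G (arc e (suc L)) ≡ arc e (suc (suc L))
  vertices-arc e L = cong (e ∷_) (map-next-arc e (suc L))

  arc-simple : ∀ e L → L ≤ m → SimplePath G (arc e L)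
  arc-simple e zero    _     = [] , []
  arc-simple e (suc L) L<n = arc-consecutive e (suc L) ,
    subst Unique (sym (vertices-arc e L)) (arc-unique e (suc (suc L)) (s≤s L<n))

  consecutive⇒arc : ∀ e es → Consecutive G (e ∷ es) → e ∷ es ≡ arc e (suc (length es))
  consecutive⇒arc e []        _                  = refl
  consecutive⇒arc e (f ∷ es) (next-e≡f ∷ links) =
    cong (e ∷_) (trans (consecutive⇒arc f es links) (cong (λ x → arc x (suc (length es))) (sym next-e≡f)))

  unique-arc⇒short : ∀ e L → Unique (arc e (suc L)) → L ≤ m
  unique-arc⇒short e L (e∉rest ∷ _) with L ≤? m
  ... | yes L≤m = L≤m
  ... | no  L≰m = contradiction (sym (walk-period e)) (applyUpTo⁻ (λ j → walk j (next e)) L e∉rest (≰⇒> L≰m))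

  simple⇒arc : ∀ e es → SimplePath G (e ∷ es) → (e ∷ es ≡ arc e (suc (length es))) × suc (length es) ≤ m
  simple⇒arc e es (links , distinct) = is-arc , unique-arc⇒short e (suc (length es))
      (subst Unique (trans (cong (vertices G) is-arc) (vertices-arc e (length es))) distinct)
    where
      is-arc : e ∷ es ≡ arc e (suc (length es))
      is-arc = consecutive⇒arc e es links

  chain⇒preserves : (lab : Labeling G) (e : Fin n) (L : ℕ) (ℓ : ℕ → ℕ) →
                    (∀ j → suc j < L → ℓ j < ℓ (suc j)) → (∀ j → j < L → ℓ j ∈ lab (walk j e)) →
                    Preserves G lab (arc e L)
  chain⇒preserves lab e L ℓ increasing labelled =
    applyUpTo ℓ L ,
    subst (Pointwise _∈_ (applyUpTo ℓ L)) (sym (map-applyUpTo (λ j → walk j e) lab L))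
          (applyUpTo-pointwise ℓ (lab ∘ λ j → walk j e) L labelled) ,
    applyUpTo-linked ℓ L increasing

  preserves⇒chain : (lab : Labeling G) (e : Fin n) (L : ℕ) → Preserves G lab (arc e L) →
                    Σ (ℕ → ℕ) λ ℓ → (∀ j → j < L → ℓ j ∈ lab (walk j e)) × (∀ j → suc j < L → ℓ j < ℓ (suc j))
  preserves⇒chain lab e L (ls , labelled , increasing) =
    entry ls ,
    pointwise-entry (lab ∘ λ j → walk j e) L labelled′ ,
    λ j 1+j<L → linked-entry increasing j (subst (suc j <_) (sym length-ls) 1+j<L)
    where
      labelled′ : Pointwise _∈_ ls (applyUpTo (lab ∘ λ j → walk j e) L)
      labelled′ = subst (Pointwise _∈_ ls) (map-applyUpTo (λ j → walk j e) lab L) labelled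
      length-ls : length ls ≡ L
      length-ls = trans (Pointwise-length labelled′) (length-applyUpTo _ L)

  chains⇒allPaths : (lab : Labeling G) (b : Fin n → ℕ) →
                    (∀ s j → j < m → b s + j ∈ lab (walk j s)) → AllPaths G lab
  chains⇒allPaths lab b labelled []       _      = [] , [] , []
  chains⇒allPaths lab b labelled (e ∷ es) simple with simple⇒arc e es simple
  ... | is-arc , short = subst (Preserves G lab) (sym is-arc)
          (chain⇒preserves lab e (suc (length es)) (b e +_)
            (λ j _ → +-monoʳ-< (b e) (n<1+n j))
            (λ j j<L → labelled e j (<-≤-trans j<L short)))

-- Lower bounds, for the ring on n = M+2 vertices and age at most (n−1)+k

slack-identity : ∀ m₀ j d k → m₀ + (suc (j + d) + k) ≡ suc (m₀ + j + k + d)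
slack-identity = solve-∀

block-identity : ∀ m₀ x k → suc (m₀ + x + k) ≡ m₀ + (suc k + x)
block-identity = solve-∀

module LowerBound (M : ℕ) (k : ℕ) where
  open Ring (suc M)

  module _ (lab : Labeling G) (all-paths : AllPaths G lab) (age : AgeAtMost G lab (suc M + k)) where

    m₀ : ℕ
    m₀ = proj₁ age

    window : ∀ e l → l ∈ lab e → m₀ ≤ l × l < m₀ + (suc M + k)
    window = proj₂ age

    maximal-chain : (s : Fin n) → Σ (ℕ → ℕ) λ ℓ →
                    (∀ j → j < suc M → ℓ j ∈ lab (walk j s)) × (∀ j → suc j < suc M → ℓ j < ℓ (suc j))
    maximal-chain s = preserves⇒chain lab s (suc M) (all-paths (arc s (suc M)) (arc-simple s (suc M) ≤-refl))

    chain : Fin n → ℕ → ℕ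
    chain s = proj₁ (maximal-chain s)

    chain-mem : ∀ s j → j < suc M → chain s j ∈ lab (walk j s)
    chain-mem s = proj₁ (proj₂ (maximal-chain s))

    chain-gap : ∀ s j d → j + d ≡ M → chain s j + d ≤ chain s M
    chain-gap s j d j+d≡M = subst (λ x → chain s j + d ≤ chain s x) j+d≡M
      (increasing⇒gap (chain s) (suc M) (proj₂ (proj₂ (maximal-chain s))) j d (s≤s (≤-reflexive j+d≡M)))

    chain-low : ∀ s j → j < suc M → m₀ + j ≤ chain s j
    chain-low s j j<m = ≤-trans (+-monoˡ-≤ j (proj₁ (window s (chain s 0) (chain-mem s 0 (s≤s z≤n)))))
                                (increasing⇒gap (chain s) (suc M) (proj₂ (proj₂ (maximal-chain s))) 0 j j<m)

    -- ... and at most m₀+j+k, since the chain still climbs M−j steps inside the window.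
    chain-high : ∀ s j d → j + d ≡ M → chain s j ≤ m₀ + j + k
    chain-high s j d j+d≡M = +-cancelʳ-≤ d _ _ (≤-pred (begin-strict
        chain s j + d          ≤⟨ chain-gap s j d j+d≡M ⟩
        chain s M              <⟨ proj₂ (window (walk M s) (chain s M) (chain-mem s M ≤-refl)) ⟩
        m₀ + (suc M + k)       ≡⟨ cong (λ x → m₀ + (suc x + k)) (sym j+d≡M) ⟩
        m₀ + (suc (j + d) + k) ≡⟨ slack-identity m₀ j d k ⟩
        suc (m₀ + j + k + d)   ∎))
      where open ≤-Reasoning

    chain-tight : ∀ s → chain s M < m₀ + suc M → ∀ j d → j + d ≡ M → chain s j ≡ m₀ + j
    chain-tight s top< j d j+d≡M = ≤-antisym (+-cancelʳ-≤ d _ _ (begin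
        chain s j + d ≤⟨ chain-gap s j d j+d≡M ⟩
        chain s M     ≤⟨ ≤-pred (subst (chain s M <_) (+-suc m₀ M) top<) ⟩
        m₀ + M        ≡⟨ cong (m₀ +_) (sym j+d≡M) ⟩
        m₀ + (j + d)  ≡⟨ sym (+-assoc m₀ j d) ⟩
        m₀ + j + d    ∎))
      (chain-low s j (s≤s (≤-trans (m≤m+n j d) (≤-reflexive j+d≡M))))
      where open ≤-Reasoning

    near : Fin n → ℕ → ℕ
    near e p = chain (back p e) p

    near-mem : ∀ e p → p < suc M → near e p ∈ lab e
    near-mem e p p<m = subst (λ x → near e p ∈ lab x) (walk-back p e (≤-trans (<⇒≤ p<m) (n≤1+n _)))
                             (chain-mem (back p e) p p<m)

    near-high : ∀ e p → p < suc M → near e p ≤ m₀ + p + k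
    near-high e p p<m = chain-high (back p e) p (M ∸ p) (m+[n∸m]≡n (≤-pred p<m))

    c q : ℕ
    c = suc k
    q = suc M / c

    block-fits : ∀ i → i < q → suc i * c ≤ suc M
    block-fits i i<q = ≤-trans (*-monoˡ-≤ c i<q) (m/n*n≤m (suc M) c)

    position<m : ∀ i → i < q → i * c < suc M
    position<m i i<q = <-≤-trans (m<n+m (i * c) (s≤s z≤n)) (block-fits i i<q)

    hit : Fin n → ℕ → ℕ
    hit e i = near e (i * c)

    hit<next-block : ∀ e i → i < q → hit e i < m₀ + suc i * c
    hit<next-block e i i<q = subst (suc (hit e i) ≤_) (block-identity m₀ (i * c) k)
                                   (s≤s (near-high e (i * c) (position<m i i<q)))

    hit-below : ∀ e i → i < q → hit e i < m₀ + suc M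
    hit-below e i i<q = <-≤-trans (hit<next-block e i i<q) (+-monoʳ-≤ m₀ (block-fits i i<q))

    hits : Fin n → List ℕ
    hits e = applyUpTo (hit e) q

    hits-increasing : ∀ e → Linked _<_ (hits e)
    hits-increasing e = applyUpTo-linked (hit e) q λ i 1+i<q →
      <-≤-trans (hit<next-block e i (<-trans (n<1+n i) 1+i<q))
                (chain-low (back (suc i * c) e) (suc i * c) (position<m (suc i) 1+i<q))

    hits⊆lab : ∀ e {x} → x ∈ hits e → x ∈ lab e
    hits⊆lab e x∈hits with ∈-applyUpTo⁻ (hit e) x∈hits
    ... | i , i<q , refl = near-mem e (i * c) (position<m i i<q)

    every-edge-has-q-labels : ∀ e → q ≤ length (lab e)
    every-edge-has-q-labels e = subst (_≤ length (lab e)) (length-applyUpTo (hit e) q)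
      (unique⊆⇒length≤ (increasing⇒unique (hits-increasing e)) (hits⊆lab e))

    extra-label : ∀ e t → t ∈ lab e → m₀ + suc M ≤ t → suc q ≤ length (lab e)
    extra-label e t t∈lab t-high = subst (λ x → suc x ≤ length (lab e)) (length-applyUpTo (hit e) q)
        (unique⊆⇒length≤ {xs = t ∷ hits e} (t∉hits ∷ increasing⇒unique (hits-increasing e)) t∷hits⊆lab)
      where
        t∉hits : All (t ≢_) (hits e)
        t∉hits = applyUpTo⁺₁ (hit e) q λ i<q t≡hit → <⇒≢ (<-≤-trans (hit-below e _ i<q) t-high) (sym t≡hit)
        t∷hits⊆lab : ∀ {x} → x ∈ t ∷ hits e → x ∈ lab e
        t∷hits⊆lab (here refl)   = t∈lab
        t∷hits⊆lab (there x∈hits) = hits⊆lab e x∈hits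

    overflow-or-tight : ∀ e₀ j → j < suc M → (∃ λ e → suc q ≤ length (lab e)) ⊎ m₀ + j ∈ lab e₀
    overflow-or-tight e₀ j j<m with chain (back j e₀) M <? m₀ + suc M
    ... | yes top< = inj₂ (subst (_∈ lab e₀) (chain-tight (back j e₀) top< j (M ∸ j) (m+[n∸m]≡n (≤-pred j<m)))
                                 (near-mem e₀ j j<m))
    ... | no  top≮ = inj₁ (walk M (back j e₀) ,
                           extra-label _ _ (chain-mem (back j e₀) M ≤-refl) (≮⇒≥ top≮))

    some-edge-has-q+1-labels : 1 ≤ k → ∃ λ e → suc q ≤ length (lab e)
    some-edge-has-q+1-labels 1≤k with all-or-some (suc M) (overflow-or-tight fzero)
    ... | inj₁ overflow = overflow
    ... | inj₂ tight    = fzero , ≤-trans (m/n<m (suc M) c (s≤s 1≤k)) all-labels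
      where
        all-labels : suc M ≤ length (lab fzero)
        all-labels = subst (_≤ length (lab fzero)) (length-applyUpTo (m₀ +_) (suc M))
          (unique⊆⇒length≤ (increasing⇒unique (applyUpTo-linked (m₀ +_) (suc M) λ i _ → +-monoʳ-< m₀ (n<1+n i)))
            λ x∈ → let (i , i<m , x≡) = ∈-applyUpTo⁻ (m₀ +_) x∈ in subst (_∈ lab fzero) (sym x≡) (tight i i<m))

  τ-lower : 1 ≤ k → τ≥ G (suc M + k) (suc M / suc k + 1)
  τ-lower 1≤k lab (_ , all-paths , age) with some-edge-has-q+1-labels lab all-paths age 1≤k
  ... | e , q+1≤ = e , subst (_≤ length (lab e)) (+-comm 1 (suc M / suc k)) q+1≤

-- For age n−1 (k = 0) the blocks have length 1, so every edge carries n−1 labels.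
τ-lower-exact : (M : ℕ) → τ≥ (ring (suc (suc M))) (suc M) (suc M)
τ-lower-exact M lab (_ , all-paths , age) =
  fzero , subst (_≤ length (lab fzero)) (n/1≡n (suc M))
    (LowerBound.every-edge-has-q-labels M 0 lab all-paths (age-mono (ring (suc (suc M))) lab (m≤m+n (suc M) 0) age) fzero)

-- Upper bounds, for the ring on n = M+2 vertices

remainder-identity : ∀ r b j → r + b + j ≡ r + j + b
remainder-identity = solve-∀

module UpperBound (M k : ℕ) where
  open Ring (suc M)

  c D : ℕ
  c = suc k
  D = suc M / c

  -- For i ≤ ⌊v/c⌋ it serves the arcs
  -- starting at s ≤ v with ⌊s/c⌋ = i; otherwise the arcs that start at s > v, pass
  -- vertex 0 and have ⌊s/c⌋ = i−1.  Either way the label is s mod c + (distance from s).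
  blockLabel : ℕ → ℕ → ℕ
  blockLabel v i with i ≤? v / c
  ... | yes _ = v ∸ i * c
  ... | no  _ = (v + n) ∸ (i ∸ 1) * c

  -- Capping at M+k keeps all labels in the window [0, (n−1)+k); chains never use capped values.
  offer : ℕ → ℕ → ℕ
  offer v i = blockLabel v i ⊓ (M + k)

  lab : Labeling G
  lab e = deduplicate _≟_ (applyUpTo (offer (toℕ e)) (2 + D))

  offered : ∀ e i → i < 2 + D → offer (toℕ e) i ∈ lab e
  offered e i i<2+D = ∈-deduplicate⁺ _≟_ (∈-applyUpTo⁺ (offer (toℕ e)) i<2+D)

  remainder-shift : ∀ s j w → w ≡ s + j → w ∸ s / c * c ≡ s % c + j
  remainder-shift s j w w≡s+j = begin
      w ∸ s / c * c                     ≡⟨ cong (_∸ s / c * c) (trans w≡s+j (cong (_+ j) (m≡m%n+[m/n]*n s c))) ⟩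
      s % c + s / c * c + j ∸ s / c * c ≡⟨ cong (_∸ s / c * c) (remainder-identity (s % c) (s / c * c) j) ⟩
      s % c + j + s / c * c ∸ s / c * c ≡⟨ m+n∸n≡m (s % c + j) (s / c * c) ⟩
      s % c + j                         ∎
    where open ≡-Reasoning

  label-within : ∀ s j v → v ≡ s + j → blockLabel v (s / c) ≡ s % c + j
  label-within s j v v≡s+j with s / c ≤? v / c
  ... | yes _   = remainder-shift s j v v≡s+j
  ... | no  s≰v = contradiction (/-monoˡ-≤ c (subst (s ≤_) (sym v≡s+j) (m≤m+n s j))) s≰v

  label-wrap : ∀ s j v → v + n ≡ s + j → v ≤ s → blockLabel v (suc (s / c)) ≡ s % c + j
  label-wrap s j v v+n≡s+j v≤s with suc (s / c) ≤? v / c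
  ... | yes s<v = contradiction (/-monoˡ-≤ c v≤s) (<⇒≱ s<v)
  ... | no  _   = remainder-shift s j (v + n) v+n≡s+j

  uncapped : ∀ s j → j < suc M → (s % c + j) ⊓ (M + k) ≡ s % c + j
  uncapped s j j<m = m≤n⇒m⊓n≡m (≤-trans (+-mono-≤ (≤-pred (m%n<n s c)) (≤-pred j<m)) (≤-reflexive (+-comm k M)))

  block≤D : ∀ (s : Fin n) → toℕ s / c ≤ D
  block≤D s = /-monoˡ-≤ c (≤-pred (toℕ<n s))

  start-label : ∀ s j → j < suc M → toℕ s % c + j ∈ lab (walk j s)
  start-label s j j<m with toℕ s + j <? n
  ... | yes within = subst (_∈ lab (walk j s))
          (trans (cong (_⊓ (M + k)) (label-within (toℕ s) j _ (walk-within j s within))) (uncapped (toℕ s) j j<m))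
          (offered (walk j s) (toℕ s / c) (s≤s (≤-trans (block≤D s) (n≤1+n D))))
  ... | no  wraps  = subst (_∈ lab (walk j s))
          (trans (cong (_⊓ (M + k)) (label-wrap (toℕ s) j _ v+n≡s+j v≤s)) (uncapped (toℕ s) j j<m))
          (offered (walk j s) (suc (toℕ s / c)) (s≤s (s≤s (block≤D s))))
    where
      j≤n : j ≤ n
      j≤n = ≤-trans (<⇒≤ j<m) (n≤1+n (suc M))
      v+n≡s+j : toℕ (walk j s) + n ≡ toℕ s + j
      v+n≡s+j = walk-wrap j s (≮⇒≥ wraps) j≤n
      v≤s : toℕ (walk j s) ≤ toℕ s
      v≤s = +-cancelʳ-≤ n _ _ (≤-trans (≤-reflexive v+n≡s+j) (+-monoʳ-≤ (toℕ s) j≤n))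

  lab-window : ∀ e l → l ∈ lab e → 0 ≤ l × l < 0 + (suc M + k)
  lab-window e l l∈lab with ∈-applyUpTo⁻ (offer (toℕ e)) (∈-deduplicate⁻ _≟_ (applyUpTo (offer (toℕ e)) (2 + D)) l∈lab)
  ... | i , _ , refl = z≤n , s≤s (m⊓n≤n _ (M + k))

  lab-size : ∀ e → length (lab e) ≤ 2 + D
  lab-size e = ≤-trans (length-deduplicate _≟_ (applyUpTo (offer (toℕ e)) (2 + D))) (≤-reflexive (length-applyUpTo (offer (toℕ e)) (2 + D)))

  -- ⌈n/(k+1)⌉ = ⌊(n−1)/(k+1)⌋ + 1, since n + k = (n−1) + (k+1).
  ceil≡D+1 : ceil/ n k ≡ suc D
  ceil≡D+1 = begin
      (suc (suc M) + k) / c   ≡⟨ cong (_/ c) (sym (+-suc (suc M) k)) ⟩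
      (suc M + c) / c         ≡⟨ m/n≡1+[m∸n]/n (m≤n+m c (suc M)) ⟩
      suc ((suc M + c ∸ c) / c) ≡⟨ cong (λ x → suc (x / c)) (m+n∸n≡m (suc M) c) ⟩
      suc D                   ∎
    where open ≡-Reasoning

  τ-upper : τ≤ G (suc M + k) (ceil/ n k + 1)
  τ-upper = lab ,
    ((λ e → deduplicate-! (applyUpTo (offer (toℕ e)) (2 + D))) , chains⇒allPaths lab (λ s → toℕ s % c) start-label , 0 , lab-window) ,
    λ e → ≤-trans (lab-size e) (≤-reflexive (trans (+-comm 1 (suc D)) (cong (_+ 1) (sym ceil≡D+1))))

τ-upper-exact : (M : ℕ) → τ≤ (ring (suc (suc M))) (suc M) (suc M)
τ-upper-exact M =
  every-label ,
  ((λ _ → upTo⁺ (suc M)) ,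
   chains⇒allPaths every-label (λ _ → 0) (λ _ _ j<m → ∈-upTo⁺ j<m) ,
   0 , λ _ _ l∈ → z≤n , ∈-upTo⁻ l∈) ,
  λ _ → ≤-reflexive (length-upTo (suc M))
  where
    open Ring (suc M)
    every-label : Labeling G
    every-label _ = upTo (suc M)

theorem6 : (n : ℕ) → 2 ≤ n →
           ((k : ℕ) → 1 ≤ k → k ≤ n ∸ 1 →
             τ≥ (ring n) ((n ∸ 1) + k) ((n ∸ 1) / suc k + 1)
             × τ≤ (ring n) ((n ∸ 1) + k) (ceil/ n k + 1))
           × (τ≥ (ring n) (n ∸ 1) (n ∸ 1) × τ≤ (ring n) (n ∸ 1) (n ∸ 1))
theorem6 (suc (suc M)) (s≤s (s≤s z≤n)) =
  (λ k 1≤k _ → LowerBound.τ-lower M k 1≤k , UpperBound.τ-upper M k) ,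
  τ-lower-exact M ,
  τ-upper-exact M
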